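{- Let $G$ be a finite simple graph with minimum degree $\delta$, connectivity $\kappa$ and circumference $c$, and let $S$ be a minimum cut-set of $G$. If every longest cycle in $G$ is a dominating cycle, then either $c\geq 3\delta-\kappa+1$, or there exists a longest cycle $C$ of $G$ with $S\subseteq V(C)$.
   Context: All graphs are finite, undirected, without loops or multiple edges. The minimum degree $\delta$ is the smallest vertex degree of $G$; the connectivity $\kappa$ is the minimum size of a vertex set whose removal disconnects $G$; a minimum cut-set is a set $S\subseteq V(G)$ with $|S|=\kappa$ such that $G\setminus S$ (the subgraph induced on $V(G)\setminus S$) is disconnected. The circumference $c$ is the length of a longest cycle in $G$. A cycle $C$ is a dominating cycle if $G\setminus V(C)$ has no edges. -}

module Defs where

open import Data.Nat using (ℕ; _≤_)
open import Data.Bool using (Bool; true; false)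
open import Data.Fin using (Fin)
open import Data.Fin.Subset using (Subset; _∈_; _∉_; ∣_∣)
open import Data.Vec using (tabulate)
open import Data.List using (List; []; _∷_; length; _++_; take)
open import Data.List.Relation.Unary.Unique.Propositional using (Unique)
import Data.List.Membership.Propositional as LM
open import Data.Product using (Σ; _×_; ∃)
open import Data.Sum using (_⊎_)
open import Data.Unit using (⊤)
open import Relation.Nullary using (¬_)
open import Relation.Binary.PropositionalEquality using (_≡_)

record Graph (n : ℕ) : Set where
  field
    adj    : Fin n → Fin n → Bool
    sym    : ∀ u v → adj u v ≡ adj v u
    irrefl : ∀ v → adj v v ≡ false
open Graph public

module _ {n : ℕ} (G : Graph n) where

  Edge : Fin n → Fin n → Set
  Edge u v = adj G u v ≡ true

  degree : Fin n → ℕ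
  degree v = ∣ tabulate (adj G v) ∣

  IsMinDegree : ℕ → Set
  IsMinDegree d = (∃ λ v → degree v ≡ d) × (∀ v → d ≤ degree v)

  data Reach (S : Subset n) (u : Fin n) : Fin n → Set where
    here : u ∉ S → Reach S u u
    step : ∀ {v w} → Reach S u v → Edge v w → w ∉ S → Reach S u w

  Disconnects : Subset n → Set
  Disconnects S = Σ (Fin n) λ u → Σ (Fin n) λ w →
    u ∉ S × w ∉ S × ¬ Reach S u w

  -- S is a minimum cut-set: G \ S disconnected and |S| is minimum among such sets
  -- (so |S| = κ(G)).
  IsMinCutSet : Subset n → Set
  IsMinCutSet S = Disconnects S × (∀ T → Disconnects T → ∣ S ∣ ≤ ∣ T ∣)

  PathAdj : List (Fin n) → Set
  PathAdj []            = ⊤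
  PathAdj (x ∷ [])      = ⊤
  PathAdj (x ∷ y ∷ r)   = Edge x y × PathAdj (y ∷ r)

  -- a cycle v₀ v₁ … v_{k-1} (k ≥ 3, distinct vertices, v_{k-1} v₀ an edge);
  -- its length is the length of the list
  IsCycle : List (Fin n) → Set
  IsCycle vs = 3 ≤ length vs × Unique vs × PathAdj (vs ++ take 1 vs)

  IsCircumference : ℕ → Set
  IsCircumference c = (∃ λ C → IsCycle C × length C ≡ c)
                    × (∀ C → IsCycle C → length C ≤ c)

  IsLongestCycle : ℕ → List (Fin n) → Set
  IsLongestCycle c C = IsCycle C × length C ≡ c

  IsDominating : List (Fin n) → Set
  IsDominating C = ∀ u v → Edge u v → LM._∈_ u C ⊎ LM._∈_ v C

-- Let L be a longest cycle and s ∈ S a vertex off L. As L dominates, all neighbours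
-- of s lie on L. For three consecutive vertices a b y of L, s is not adjacent to
-- both a and b (insert s between them to get a longer cycle), and if s is adjacent
-- to a and y then either b ∈ S or replacing b by s gives a longest cycle meeting S
-- in one more vertex. In the latter case we repeat, which terminates since |S ∩ V(L)|
-- is bounded by |S|. Otherwise each window a b y carries at most 1 + [b ∈ S]
-- neighbours of s, and summing over all c windows gives
-- 3 δ ≤ 3 deg(s) ≤ c + |S ∩ V(L)| ≤ c + |S| − 1.
module Submission where

open import Defs
open import Data.Nat using (ℕ; zero; suc; _+_; _*_; _≤_; _<_; z≤n; s≤s)
open import Data.Nat.Properties
open import Data.Nat.ListAction using (sum)
open import Data.Nat.ListAction.Properties using (sum-↭)
open import Algebra.Properties.CommutativeSemigroup +-commutativeSemigroup using (interchange)
open import Data.Bool using (Bool; true; false)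
open import Data.Bool.Properties using () renaming (_≟_ to _≟ᵇ_)
open import Data.Empty using (⊥; ⊥-elim)
open import Data.Fin using (Fin)
import Data.Fin as Fin
open import Data.Fin.Properties using (any?) renaming (_≟_ to _≟ᶠ_)
open import Data.Fin.Subset using (Subset; ∣_∣)
import Data.Fin.Subset as FS
open import Data.Fin.Subset.Properties using (_∈?_)
open import Data.Vec using (lookup; tabulate)
open import Data.Vec.Properties using ([]=⇒lookup; tabulate∘lookup)
open import Data.List using (List; []; _∷_; [_]; _++_; length; map; allFin)
import Data.List as List
open import Data.List.Properties using (++-assoc; ++-identityʳ; map-∘)
open import Data.List.Membership.Propositional using (_∈_; _∉_)
import Data.List.Membership.Propositional as LM
import Data.List.Membership.DecPropositional as DecMembership
open import Data.List.Membership.Propositional.Properties using (∈-∃++; ∈-allFin)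
open import Data.List.Relation.Binary.Permutation.Propositional
  using (_↭_; ↭-refl; ↭-sym; ↭-trans; ↭⇒↭ₛ)
open import Data.List.Relation.Binary.Permutation.Propositional.Properties
  using (∈-resp-↭; ↭-length; map⁺; shift; ∷↭∷ʳ)
import Data.List.Relation.Binary.Permutation.Setoid.Properties as PermutationSetoid
open import Data.List.Relation.Unary.All using (All; []; _∷_)
import Data.List.Relation.Unary.All as All
open import Data.List.Relation.Unary.All.Properties using (¬Any⇒All¬)
open import Data.List.Relation.Unary.AllPairs using ([]; _∷_)
open import Data.List.Relation.Unary.Any using (here; there)
import Data.List.Relation.Unary.Any as Any
open import Data.List.Relation.Unary.Unique.Propositional using (Unique)
open import Data.List.Relation.Unary.Unique.Propositional.Properties using (allFin⁺)
open import Data.Product using (Σ; ∃; _×_; _,_)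
open import Data.Sum using (_⊎_; inj₁; inj₂)
open import Data.Unit using (tt)
open import Function using (_∘_)
open import Relation.Binary.PropositionalEquality
  using (_≡_; refl; trans; cong; cong₂; subst; module ≡-Reasoning)
import Relation.Binary.PropositionalEquality as ≡
open import Relation.Binary.PropositionalEquality.Properties using (setoid)
open import Relation.Nullary using (¬_; yes; no; ¬?)
open import Relation.Nullary.Decidable using (_×-dec_; decidable-stable)
open import Relation.Unary using (Decidable)

indicator : Bool → ℕ
indicator true  = 1
indicator false = 0

sum-map-+ : ∀ {A : Set} (f g : A → ℕ) xs →
            sum (map (λ x → f x + g x) xs) ≡ sum (map f xs) + sum (map g xs)
sum-map-+ f g []       = refl
sum-map-+ f g (x ∷ xs) = trans (cong (f x + g x +_) (sum-map-+ f g xs))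
                               (interchange (f x) (g x) (sum (map f xs)) (sum (map g xs)))

sum-map-mono : ∀ {A : Set} {f g : A → ℕ} {xs} →
               All (λ x → f x ≤ g x) xs → sum (map f xs) ≤ sum (map g xs)
sum-map-mono []          = ≤-refl
sum-map-mono (fx≤gx ∷ p) = +-mono-≤ fx≤gx (sum-map-mono p)

sum-map-1 : ∀ {A : Set} (xs : List A) → sum (map (λ _ → 1) xs) ≡ length xs
sum-map-1 []       = refl
sum-map-1 (x ∷ xs) = cong suc (sum-map-1 xs)

module _ {A : Set} where

  count : (A → Bool) → List A → ℕ
  count p xs = sum (map (indicator ∘ p) xs)

  count-↭ : ∀ p {xs ys} → xs ↭ ys → count p xs ≡ count p ys
  count-↭ p xs↭ys = sum-↭ (map⁺ (indicator ∘ p) xs↭ys)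

  count-mono : ∀ p {xs} ys → Unique xs → (∀ {x} → x ∈ xs → p x ≡ true → x ∈ ys) →
               count p xs ≤ count p ys
  count-mono p ys [] _ = z≤n
  count-mono p {x ∷ xs} ys (x∉xs ∷ xs!) xs⊆ys with p x in px
  ... | false = count-mono p ys xs! (xs⊆ys ∘ there)
  ... | true with ys₁ , ys₂ , refl ← ∈-∃++ (xs⊆ys (here refl) px) = begin
    1 + count p xs                   ≤⟨ s≤s (count-mono p (ys₁ ++ ys₂) xs! xs⊆ys′) ⟩
    1 + count p (ys₁ ++ ys₂)         ≡⟨ cong (λ b → indicator b + count p (ys₁ ++ ys₂)) px ⟨
    count p (x ∷ ys₁ ++ ys₂)         ≡⟨ count-↭ p (shift x ys₁ ys₂) ⟨
    count p (ys₁ ++ x ∷ ys₂)         ∎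
    where
    open ≤-Reasoning
    xs⊆ys′ : ∀ {y} → y ∈ xs → p y ≡ true → y ∈ ys₁ ++ ys₂
    xs⊆ys′ y∈xs py with ∈-resp-↭ (shift x ys₁ ys₂) (xs⊆ys (there y∈xs) py)
    ... | here refl = ⊥-elim (All.lookup x∉xs y∈xs refl)
    ... | there y∈ys = y∈ys

  count-tabulate : ∀ {k} (p : A → Bool) (h : Fin k → A) →
                   count p (List.tabulate h) ≡ ∣ tabulate (p ∘ h) ∣
  count-tabulate {zero}  p h = refl
  count-tabulate {suc k} p h with p (h Fin.zero) | count-tabulate p (h ∘ Fin.suc)
  ... | true  | eq = cong suc eq
  ... | false | eq = eq

module _ {n : ℕ} where

  open DecMembership (_≟ᶠ_ {n}) using () renaming (_∈?_ to _∈ˡ?_)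

  ∣tabulate∣≡count-allFin : (p : Fin n → Bool) → ∣ tabulate p ∣ ≡ count p (allFin n)
  ∣tabulate∣≡count-allFin p = ≡.sym (count-tabulate p (λ i → i))

  count-≤-∣tabulate∣ : ∀ (p : Fin n → Bool) {xs} → Unique xs → count p xs ≤ ∣ tabulate p ∣
  count-≤-∣tabulate∣ p {xs} xs! = begin
    count p xs          ≤⟨ count-mono p (allFin n) xs! (λ {x} _ _ → ∈-allFin x) ⟩
    count p (allFin n)  ≡⟨ ∣tabulate∣≡count-allFin p ⟨
    ∣ tabulate p ∣      ∎
    where open ≤-Reasoning

  ∣tabulate∣-≤-count : ∀ (p : Fin n → Bool) xs → (∀ {x} → p x ≡ true → x ∈ xs) →
                       ∣ tabulate p ∣ ≤ count p xs
  ∣tabulate∣-≤-count p xs p⊆xs = begin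
    ∣ tabulate p ∣      ≡⟨ ∣tabulate∣≡count-allFin p ⟩
    count p (allFin n)  ≤⟨ count-mono p xs (allFin⁺ n) (λ _ → p⊆xs) ⟩
    count p xs          ∎
    where open ≤-Reasoning

  count-lookup-≤-∣∣ : ∀ (S : Subset n) {xs} → Unique xs → count (lookup S) xs ≤ ∣ S ∣
  count-lookup-≤-∣∣ S xs! =
    ≤-trans (count-≤-∣tabulate∣ (lookup S) xs!) (≤-reflexive (cong ∣_∣ (tabulate∘lookup S)))

  count-lookup-<-∣∣ : ∀ (S : Subset n) {s xs} → s FS.∈ S → s ∉ xs → Unique xs →
                      count (lookup S) xs < ∣ S ∣
  count-lookup-<-∣∣ S {s} {xs} s∈S s∉xs xs! = begin
    suc (count (lookup S) xs)  ≡⟨ cong (λ b → indicator b + count (lookup S) xs) ([]=⇒lookup s∈S) ⟨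
    count (lookup S) (s ∷ xs)  ≤⟨ count-lookup-≤-∣∣ S (¬Any⇒All¬ xs s∉xs ∷ xs!) ⟩
    ∣ S ∣                      ∎
    where open ≤-Reasoning

  ⊆-or-missing : ∀ (S : Subset n) xs → (∀ v → v FS.∈ S → v ∈ xs) ⊎ ∃ λ v → v FS.∈ S × v ∉ xs
  ⊆-or-missing S xs with any? (λ v → (v ∈? S) ×-dec ¬? (v ∈ˡ? xs))
  ... | yes missing = inj₂ missing
  ... | no ¬missing = inj₁ λ v v∈S →
    decidable-stable (v ∈ˡ? xs) (λ v∉xs → ¬missing (v , v∈S , v∉xs))

module _ {A : Set} where

  rotate : List A → List A
  rotate []       = []
  rotate (x ∷ xs) = xs ++ [ x ]

  rotate-↭ : ∀ xs → rotate xs ↭ xs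
  rotate-↭ []       = ↭-refl
  rotate-↭ (x ∷ xs) = ↭-sym (∷↭∷ʳ x xs)

  length-rotate : ∀ xs → length (rotate xs) ≡ length xs
  length-rotate xs = ↭-length (rotate-↭ xs)

  Unique-rotate : ∀ {xs} → Unique xs → Unique (rotate xs)
  Unique-rotate {xs} = PermutationSetoid.Unique-resp-↭ (setoid A) (↭⇒↭ₛ (↭-sym (rotate-↭ xs)))

  rotationsFrom : ℕ → List A → List (List A)
  rotationsFrom zero    xs = []
  rotationsFrom (suc k) xs = xs ∷ rotationsFrom k (rotate xs)

  rotations : List A → List (List A)
  rotations xs = rotationsFrom (length xs) xs

  All-rotations : ∀ {P : List A → Set} → (∀ {xs} → P xs → P (rotate xs)) →
                  ∀ {xs} → P xs → All P (rotations xs)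
  All-rotations {P} P-rotate {xs} = go (length xs)
    where
    go : ∀ k {xs} → P xs → All P (rotationsFrom k xs)
    go zero    _  = []
    go (suc k) px = px ∷ go k (P-rotate px)

  rotations-rotate : ∀ xs → rotations (rotate xs) ≡ map rotate (rotations xs)
  rotations-rotate xs = trans (cong (λ k → rotationsFrom k (rotate xs)) (length-rotate xs))
                              (go (length xs) xs)
    where
    go : ∀ k xs → rotationsFrom k (rotate xs) ≡ map rotate (rotationsFrom k xs)
    go zero    xs = refl
    go (suc k) xs = cong (rotate xs ∷_) (go k (rotate xs))

  length-rotations : ∀ xs → length (rotations xs) ≡ length xs
  length-rotations xs = go (length xs) xs
    where
    go : ∀ k xs → length (rotationsFrom k xs) ≡ k
    go zero    xs = refl
    go (suc k) xs = cong suc (go k (rotate xs))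

  atHead : (A → ℕ) → List A → ℕ
  atHead f []      = 0
  atHead f (x ∷ _) = f x

  map-atHead-rotations : ∀ f xs → map (atHead f) (rotations xs) ≡ map f xs
  map-atHead-rotations f xs =
    subst (λ zs → map (atHead f) (rotationsFrom (length xs) zs) ≡ map f xs)
          (++-identityʳ xs) (go xs [])
    where
    go : ∀ xs ys → map (atHead f) (rotationsFrom (length xs) (xs ++ ys)) ≡ map f xs
    go []       ys = refl
    go (x ∷ xs) ys = cong (f x ∷_) (begin
      map (atHead f) (rotationsFrom (length xs) ((xs ++ ys) ++ [ x ]))
        ≡⟨ cong (map (atHead f) ∘ rotationsFrom (length xs)) (++-assoc xs ys [ x ]) ⟩
      map (atHead f) (rotationsFrom (length xs) (xs ++ ys ++ [ x ]))
        ≡⟨ go xs (ys ++ [ x ]) ⟩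
      map f xs ∎)
      where open ≡-Reasoning

  sum-map-rotate : ∀ f xs → sum (map f (rotate xs)) ≡ sum (map f xs)
  sum-map-rotate f xs = sum-↭ (map⁺ f (rotate-↭ xs))

  map-∘rotate-rotations : ∀ (g : List A → ℕ) xs →
                          map (g ∘ rotate) (rotations xs) ≡ map g (rotations (rotate xs))
  map-∘rotate-rotations g xs =
    trans (map-∘ (rotations xs)) (cong (map g) (≡.sym (rotations-rotate xs)))

  sum-map-atHead-rotations : ∀ f xs → sum (map (atHead f) (rotations xs)) ≡ sum (map f xs)
  sum-map-atHead-rotations f xs = cong sum (map-atHead-rotations f xs)

  sum-map-atHead∘rotate-rotations : ∀ f xs →
    sum (map (atHead f ∘ rotate) (rotations xs)) ≡ sum (map f xs)
  sum-map-atHead∘rotate-rotations f xs = begin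
    sum (map (atHead f ∘ rotate) (rotations xs)) ≡⟨ cong sum (map-∘rotate-rotations (atHead f) xs) ⟩
    sum (map (atHead f) (rotations (rotate xs))) ≡⟨ sum-map-atHead-rotations f (rotate xs) ⟩
    sum (map f (rotate xs))                      ≡⟨ sum-map-rotate f xs ⟩
    sum (map f xs)                               ∎
    where open ≡-Reasoning

  window : (A → ℕ) → List A → ℕ
  window f xs = atHead f xs + atHead f (rotate xs) + atHead f (rotate (rotate xs))

  sum-map-window-rotations : ∀ f xs → sum (map (window f) (rotations xs)) ≡ 3 * sum (map f xs)
  sum-map-window-rotations f xs = begin
    sum (map (window f) (rotations xs))
      ≡⟨ sum-map-+ (λ R → atHead f R + atHead f (rotate R)) (atHead f ∘ rotate ∘ rotate)
                   (rotations xs) ⟩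
    sum (map (λ R → atHead f R + atHead f (rotate R)) (rotations xs))
      + sum (map (atHead f ∘ rotate ∘ rotate) (rotations xs))
      ≡⟨ cong₂ _+_ (sum-map-+ (atHead f) (atHead f ∘ rotate) (rotations xs))
                   (cong sum (map-∘rotate-rotations (atHead f ∘ rotate) xs)) ⟩
    sum (map (atHead f) (rotations xs)) + sum (map (atHead f ∘ rotate) (rotations xs))
      + sum (map (atHead f ∘ rotate) (rotations (rotate xs)))
      ≡⟨ cong₂ _+_ (cong₂ _+_ (sum-map-atHead-rotations f xs)
                              (sum-map-atHead∘rotate-rotations f xs))
                   (trans (sum-map-atHead∘rotate-rotations f (rotate xs)) (sum-map-rotate f xs)) ⟩
    Σf + Σf + Σf
      ≡⟨ trans (+-assoc Σf Σf Σf) (cong (λ t → Σf + (Σf + t)) (≡.sym (+-identityʳ Σf))) ⟩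
    3 * Σf ∎
    where
    open ≡-Reasoning
    Σf : ℕ
    Σf = sum (map f xs)

module _ {n : ℕ} (G : Graph n) where

  Edge-sym : ∀ {u v} → Edge G u v → Edge G v u
  Edge-sym {u} {v} e = trans (Graph.sym G v u) e

  PathAdj-∷ʳ : ∀ {a b} xs → PathAdj G (xs ++ [ a ]) → Edge G a b →
               PathAdj G ((xs ++ [ a ]) ++ [ b ])
  PathAdj-∷ʳ []           _         e = e , tt
  PathAdj-∷ʳ (x ∷ [])     (e₁ , _)  e = e₁ , e , tt
  PathAdj-∷ʳ (x ∷ y ∷ xs) (e₁ , ps) e = e₁ , PathAdj-∷ʳ (y ∷ xs) ps e

  IsCycle-rotate : ∀ {C} → IsCycle G C → IsCycle G (rotate C)
  IsCycle-rotate {[]}            (() , _)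
  IsCycle-rotate {_ ∷ []}        (s≤s () , _)
  IsCycle-rotate {C@(a ∷ b ∷ r)} (3≤C , C! , eab , ps) =
    subst (3 ≤_) (≡.sym (length-rotate C)) 3≤C , Unique-rotate C! , PathAdj-∷ʳ (b ∷ r) ps eab

  rotations-IsCycle : ∀ {C} → IsCycle G C → All (λ R → IsCycle G R × R ↭ C) (rotations C)
  rotations-IsCycle C-cyc =
    All-rotations (λ (R-cyc , R↭C) → IsCycle-rotate R-cyc , ↭-trans (rotate-↭ _) R↭C)
                  (C-cyc , ↭-refl)

  degree-≤-count : ∀ {C s} → IsDominating G C → s ∉ C → degree G s ≤ count (adj G s) C
  degree-≤-count {C} {s} C-dom s∉C = ∣tabulate∣-≤-count (adj G s) C neighbour∈C
    where
    neighbour∈C : ∀ {v} → Edge G s v → v ∈ C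
    neighbour∈C {v} e with C-dom s v e
    ... | inj₁ s∈C = ⊥-elim (s∉C s∈C)
    ... | inj₂ v∈C = v∈C

  IsCycle-insert : ∀ {s a b r} → IsCycle G (a ∷ b ∷ r) → s ∉ a ∷ b ∷ r →
                   Edge G a s → Edge G s b → IsCycle G (a ∷ s ∷ b ∷ r)
  IsCycle-insert (_ , (a∉b∷r ∷ b∷r!) , _ , ps) s∉C eas esb =
    s≤s (s≤s (s≤s z≤n)) ,
    ((λ a≡s → s∉C (here (≡.sym a≡s))) ∷ a∉b∷r) ∷ ¬Any⇒All¬ _ (s∉C ∘ there) ∷ b∷r! ,
    eas , esb , ps

  IsCycle-replace : ∀ {s a y b r} → IsCycle G (a ∷ y ∷ b ∷ r) → s ∉ a ∷ y ∷ b ∷ r →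
                    Edge G a s → Edge G s b → IsCycle G (a ∷ s ∷ b ∷ r)
  IsCycle-replace (3≤C , ((_ ∷ a∉b∷r) ∷ (_ ∷ b∷r!)) , _ , _ , ps) s∉C eas esb =
    3≤C ,
    ((λ a≡s → s∉C (here (≡.sym a≡s))) ∷ a∉b∷r) ∷ ¬Any⇒All¬ _ (s∉C ∘ there ∘ there) ∷ b∷r! ,
    eas , esb , ps

indicator-window-≤ : ∀ p q t u → ¬ (p ≡ true × q ≡ true) → ¬ (q ≡ true × t ≡ true) →
                     ¬ (p ≡ true × t ≡ true × u ≡ false) →
                     indicator p + indicator q + indicator t ≤ 1 + indicator u
indicator-window-≤ true  true  _     _     pq _  _   = ⊥-elim (pq (refl , refl))
indicator-window-≤ _     true  true  _     _  qt _   = ⊥-elim (qt (refl , refl))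
indicator-window-≤ true  false true  false _  _  ptu = ⊥-elim (ptu (refl , refl , refl))
indicator-window-≤ true  false true  true  _  _  _   = ≤-refl
indicator-window-≤ true  false false _     _  _  _   = s≤s z≤n
indicator-window-≤ false true  false _     _  _  _   = s≤s z≤n
indicator-window-≤ false false true  _     _  _  _   = s≤s z≤n
indicator-window-≤ false false false _     _  _  _   = z≤n

module _ {n : ℕ} (G : Graph n) {c : ℕ} (c-max : ∀ C → IsCycle G C → length C ≤ c)
         (S : Subset n) {s : Fin n} (s∈S : lookup S s ≡ true) where

  no-consecutive-neighbours : ∀ {a b r} → IsCycle G (a ∷ b ∷ r) → length (a ∷ b ∷ r) ≡ c →
                              s ∉ a ∷ b ∷ r → ¬ (Edge G s a × Edge G s b)
  no-consecutive-neighbours C-cyc C-len s∉C (esa , esb) =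
    <-irrefl refl (subst (λ m → suc m ≤ c) C-len
                         (c-max _ (IsCycle-insert G C-cyc s∉C (Edge-sym G esa) esb)))

  Exchangeable : List (Fin n) → Set
  Exchangeable (a ∷ b ∷ y ∷ _) = Edge G s a × Edge G s y × lookup S b ≡ false
  Exchangeable _               = ⊥

  exchangeable? : Decidable Exchangeable
  exchangeable? []              = no λ ()
  exchangeable? (_ ∷ [])        = no λ ()
  exchangeable? (_ ∷ _ ∷ [])    = no λ ()
  exchangeable? (a ∷ b ∷ y ∷ _) =
    (adj G s a ≟ᵇ true) ×-dec (adj G s y ≟ᵇ true) ×-dec (lookup S b ≟ᵇ false)

  exchange : ∀ {R} → IsCycle G R → length R ≡ c → s ∉ R → Exchangeable R →
             ∃ λ C → IsLongestCycle G c C × count (lookup S) C ≡ suc (count (lookup S) R)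
  exchange {a ∷ b ∷ y ∷ r} R-cyc R-len s∉R (esa , esy , b∉S) =
    a ∷ s ∷ y ∷ r , (IsCycle-replace G R-cyc s∉R (Edge-sym G esa) esy , R-len) , count-eq
    where
    count-eq : count (lookup S) (a ∷ s ∷ y ∷ r) ≡ suc (count (lookup S) (a ∷ b ∷ y ∷ r))
    count-eq rewrite s∈S | b∉S = +-suc _ _

  window-≤ : ∀ {R} → IsCycle G R → length R ≡ c → s ∉ R → ¬ Exchangeable R →
             window (indicator ∘ adj G s) R ≤ 1 + atHead (indicator ∘ lookup S) (rotate R)
  window-≤ {[]}              (() , _)
  window-≤ {_ ∷ []}          (s≤s () , _)
  window-≤ {_ ∷ _ ∷ []}      (s≤s (s≤s ()) , _)
  window-≤ {R@(a ∷ b ∷ y ∷ r)} R-cyc R-len s∉R ¬exch =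
    indicator-window-≤ (adj G s a) (adj G s b) (adj G s y) (lookup S b)
      (no-consecutive-neighbours R-cyc R-len s∉R)
      (no-consecutive-neighbours (IsCycle-rotate G R-cyc) (trans (length-rotate R) R-len)
                                 (s∉R ∘ ∈-resp-↭ (rotate-↭ R)))
      ¬exch

  exchange-or-bound : ∀ {L} → IsLongestCycle G c L → s ∉ L →
    (∃ λ C → IsLongestCycle G c C × count (lookup S) L < count (lookup S) C)
    ⊎ 3 * count (adj G s) L ≤ c + count (lookup S) L
  exchange-or-bound {L} (L-cyc , L-len) s∉L with Any.any? exchangeable? (rotations L)
  ... | yes some-exch = inj₁ (All.lookupWith improve (rotations-IsCycle G L-cyc) some-exch)
    where
    improve : ∀ {R} → IsCycle G R × R ↭ L → Exchangeable R →
              ∃ λ C → IsLongestCycle G c C × count (lookup S) L < count (lookup S) C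
    improve (R-cyc , R↭L) exch
      with C , C-longest , C-count ← exchange R-cyc (trans (↭-length R↭L) L-len)
                                              (s∉L ∘ ∈-resp-↭ R↭L) exch =
      C , C-longest ,
      ≤-reflexive (trans (cong suc (count-↭ (lookup S) (↭-sym R↭L))) (≡.sym C-count))
  ... | no no-exch = inj₂ (begin
    3 * count (adj G s) L
      ≡⟨ sum-map-window-rotations (indicator ∘ adj G s) L ⟨
    sum (map (window (indicator ∘ adj G s)) (rotations L))
      ≤⟨ sum-map-mono (All.zipWith window-bound
                                   (rotations-IsCycle G L-cyc , ¬Any⇒All¬ _ no-exch)) ⟩
    sum (map (λ R → 1 + atHead (indicator ∘ lookup S) (rotate R)) (rotations L))
      ≡⟨ sum-map-+ (λ _ → 1) (atHead (indicator ∘ lookup S) ∘ rotate) (rotations L) ⟩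
    sum (map (λ _ → 1) (rotations L))
      + sum (map (atHead (indicator ∘ lookup S) ∘ rotate) (rotations L))
      ≡⟨ cong₂ _+_ (trans (sum-map-1 (rotations L)) (trans (length-rotations L) L-len))
                   (sum-map-atHead∘rotate-rotations (indicator ∘ lookup S) L) ⟩
    c + count (lookup S) L ∎)
    where
    open ≤-Reasoning
    window-bound : ∀ {R} → (IsCycle G R × R ↭ L) × ¬ Exchangeable R →
                   window (indicator ∘ adj G s) R ≤ 1 + atHead (indicator ∘ lookup S) (rotate R)
    window-bound ((R-cyc , R↭L) , ¬exch) =
      window-≤ R-cyc (trans (↭-length R↭L) L-len) (s∉L ∘ ∈-resp-↭ R↭L) ¬exch

module _ {A Q : Set} (P : A → Set) (μ : A → ℕ) (bound : ℕ)
         (μ≤bound : ∀ {a} → P a → μ a ≤ bound)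
         (improve : ∀ {a} → P a → Q ⊎ ∃ λ a′ → P a′ × μ a < μ a′) where

  bounded-ascent : ∀ {a} → P a → Q
  bounded-ascent {a} pa = go bound pa (m≤n+m bound (μ a))
    where
    go : ∀ k {a} → P a → bound ≤ μ a + k → Q
    go k pa gap with improve pa
    ... | inj₁ q = q
    go zero    pa gap | inj₂ (a′ , pa′ , μa<μa′) =
      ⊥-elim (<⇒≱ μa<μa′ (≤-trans (μ≤bound pa′) (≤-trans gap (≤-reflexive (+-identityʳ _)))))
    go (suc k) {a} pa gap | inj₂ (a′ , pa′ , μa<μa′) =
      go k pa′ (≤-trans gap (≤-trans (≤-reflexive (+-suc (μ a) k)) (+-monoˡ-≤ k μa<μa′)))

lemma1 : (n : ℕ) (G : Graph n) (δ c : ℕ) (S : Subset n) →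
    IsMinDegree G δ → IsCircumference G c → IsMinCutSet G S →
    (∀ C → IsLongestCycle G c C → IsDominating G C) →
    (3 * δ + 1 ≤ c + ∣ S ∣)
    ⊎ (Σ (List (Fin n)) λ C → IsLongestCycle G c C × (∀ v → FS._∈_ v S → LM._∈_ v C))
lemma1 n G δ c S (_ , δ≤degree) ((L₀ , L₀-longest) , c-max) _ dominating =
  bounded-ascent (IsLongestCycle G c) (count (lookup S)) ∣ S ∣
    (λ ((_ , L! , _) , _) → count-lookup-≤-∣∣ S L!) conclude-or-improve L₀-longest
  where
  conclude-or-improve : ∀ {L} → IsLongestCycle G c L →
    ((3 * δ + 1 ≤ c + ∣ S ∣)
     ⊎ (Σ (List (Fin n)) λ C → IsLongestCycle G c C × (∀ v → FS._∈_ v S → LM._∈_ v C)))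
    ⊎ ∃ λ L′ → IsLongestCycle G c L′ × count (lookup S) L < count (lookup S) L′
  conclude-or-improve {L} L-longest@((_ , L! , _) , _) with ⊆-or-missing S L
  ... | inj₁ S⊆L = inj₁ (inj₂ (L , L-longest , S⊆L))
  ... | inj₂ (s , s∈S , s∉L) with exchange-or-bound G c-max S ([]=⇒lookup s∈S) L-longest s∉L
  ...   | inj₁ better = inj₂ better
  ...   | inj₂ 3deg≤ = inj₁ (inj₁ (begin
    3 * δ + 1                    ≤⟨ +-monoˡ-≤ 1 (*-monoʳ-≤ 3 δ≤deg) ⟩
    3 * count (adj G s) L + 1    ≤⟨ +-monoˡ-≤ 1 3deg≤ ⟩
    c + count (lookup S) L + 1   ≡⟨ trans (+-assoc c _ 1) (cong (c +_) (+-comm _ 1)) ⟩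
    c + suc (count (lookup S) L) ≤⟨ +-monoʳ-≤ c (count-lookup-<-∣∣ S s∈S s∉L L!) ⟩
    c + ∣ S ∣                    ∎))
    where
    open ≤-Reasoning
    δ≤deg : δ ≤ count (adj G s) L
    δ≤deg = ≤-trans (δ≤degree s) (degree-≤-count G (dominating L L-longest) s∉L)
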